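{- For polytopes $P_1,\dots,P_r\in\mathcal{A}$, the set ${\rm Syz}^1(P_1,\dots,P_r)$ of all syzygies of $(P_1,\dots,P_r)$ is a semimodule over $\mathcal{A}$: if $(Q_1,\dots,Q_r)$ and $(R_1,\dots,R_r)$ are syzygies and $R\in\mathcal{A}$, then $(Q_1\oplus R_1,\dots,Q_r\oplus R_r)$ and $(R\odot Q_1,\dots,R\odot Q_r)$ are syzygies.
   Context: $\mathcal{A}$: lattice polytopes with vertices in $\mathbb{Z}^n_{\ge0}$ plus $0_{\mathcal{A}}$; $\oplus$ = convex hull of union, $\odot$ = Minkowski sum, $0_{\mathcal{A}}$ additive identity and absorbing. A syzygy of $(P_1,\dots,P_r)$ is a tuple $(Q_1,\dots,Q_r)\in\mathcal{A}^r$ such that every vertex of $\bigoplus_j(P_j\odot Q_j)$ lies in $P_j\odot Q_j$ for at least two distinct indices $j$ (the all-$0_{\mathcal{A}}$ tuple counts as a syzygy). -}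

module Defs where

open import Data.Nat as ℕ using (ℕ; zero; suc)
open import Data.Integer using (+_)
open import Data.Rational as ℚ using (ℚ; 0ℚ; 1ℚ; _/_)
open import Data.Fin using (Fin; zero; suc)
open import Data.Vec using (Vec; zipWith; replicate)
import Data.Vec as Vec
open import Data.List using (List; length; lookup)
open import Data.List.NonEmpty as List⁺ using (List⁺; toList; _⁺++⁺_; concatMap)
open import Data.List.Membership.Propositional using (_∈_)
open import Data.Product using (Σ; ∃; ∃-syntax; _×_)
open import Data.Empty using (⊥)
open import Relation.Binary.PropositionalEquality using (_≡_; _≢_)

Pt : ℕ → Set
Pt n = Vec ℕ n

-- Elements of 𝒜: either the special element 0_𝒜, or the lattice polytope
-- conv(S) for a nonempty finite set S of lattice points (given as a list).
data Poly (n : ℕ) : Set where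
  0𝒜   : Poly n
  conv : List⁺ (Pt n) → Poly n

-- ⊕ : convex hull of the union; 0𝒜 is the identity.
_⊕_ : ∀ {n} → Poly n → Poly n → Poly n
0𝒜 ⊕ Q = Q
conv S ⊕ 0𝒜 = conv S
conv S ⊕ conv T = conv (S ⁺++⁺ T)

-- ⊙ : Minkowski sum; 0𝒜 is absorbing.
_⊙_ : ∀ {n} → Poly n → Poly n → Poly n
0𝒜 ⊙ Q = 0𝒜
conv S ⊙ 0𝒜 = 0𝒜
conv S ⊙ conv T = conv (concatMap (λ s → List⁺.map (zipWith ℕ._+_ s) T) S)

⨁ : ∀ {n} (r : ℕ) → (Fin r → Poly n) → Poly n
⨁ zero    f = 0𝒜
⨁ (suc r) f = f zero ⊕ ⨁ r (λ i → f (suc i))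

ℚPt : ℕ → Set
ℚPt n = Vec ℚ n

embed : ∀ {n} → Pt n → ℚPt n
embed = Vec.map (λ k → (+ k) / 1)

_+ᵥ_ : ∀ {n} → ℚPt n → ℚPt n → ℚPt n
_+ᵥ_ = zipWith ℚ._+_

_·ₛ_ : ∀ {n} → ℚ → ℚPt n → ℚPt n
c ·ₛ v = Vec.map (c ℚ.*_) v

dot : ∀ {n} → ℚPt n → ℚPt n → ℚ
dot u v = Vec.foldr _ ℚ._+_ 0ℚ (zipWith ℚ._*_ u v)

sumℚ : ∀ k → (Fin k → ℚ) → ℚ
sumℚ zero    w = 0ℚ
sumℚ (suc k) w = w zero ℚ.+ sumℚ k (λ i → w (suc i))

sumᵥ : ∀ {n} k → (Fin k → ℚPt n) → ℚPt n
sumᵥ zero    v = replicate _ 0ℚ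
sumᵥ (suc k) v = v zero +ᵥ sumᵥ k (λ i → v (suc i))

InConvexHull : ∀ {n} → ℚPt n → List (Pt n) → Set
InConvexHull x L =
  Σ (Fin (length L) → ℚ) λ w →
    (∀ i → 0ℚ ℚ.≤ w i) ×
    sumℚ (length L) w ≡ 1ℚ ×
    sumᵥ (length L) (λ i → w i ·ₛ embed (lookup L i)) ≡ x

_∈ₚ_ : ∀ {n} → ℚPt n → Poly n → Set
x ∈ₚ 0𝒜 = ⊥
x ∈ₚ conv S = InConvexHull x (toList S)

IsVertex : ∀ {n} → ℚPt n → Poly n → Set
IsVertex {n} x P =
  x ∈ₚ P × ∃[ c ] (∀ (y : ℚPt n) → y ∈ₚ P → y ≢ x → dot c y ℚ.< dot c x)

IsSyzygy : ∀ {n} (r : ℕ) → (Fin r → Poly n) → (Fin r → Poly n) → Set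
IsSyzygy {n} r P Q =
  ∀ (x : ℚPt n) → IsVertex x (⨁ r (λ j → P j ⊙ Q j)) →
    ∃[ i ] ∃[ j ] (i ≢ j × x ∈ₚ (P i ⊙ Q i) × x ∈ₚ (P j ⊙ Q j))

-- A vertex x of ⨁ⱼ Pⱼ ⊙ Q′ⱼ is one of the generating lattice points, hence x = s + b with b a
-- generator of some Pⱼ ⊙ Qⱼ and s a lattice point such that s + Qᵢ ⊆ Q′ᵢ for every i: for
-- Q′ = Q ⊕ R take s = 0 (using Q or R, whichever contributed x), for Q′ = S ⊙ Q take s ∈ S.
-- Translation by s maps ⨁ᵢ Pᵢ ⊙ Qᵢ into ⨁ᵢ Pᵢ ⊙ Q′ᵢ, so the functional exposing x there
-- exposes b in ⨁ᵢ Pᵢ ⊙ Qᵢ. The syzygy Q puts b in two summands Pᵢ ⊙ Qᵢ, and translating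
-- back puts x in the corresponding summands Pᵢ ⊙ Q′ᵢ.
module Submission where

open import Data.Empty using (⊥-elim)
open import Data.Fin using (Fin; zero; suc)
open import Data.Integer as ℤ using (+_)
import Data.Integer.Properties as ℤP
open import Data.List as List using (List; []; _∷_; _++_; length; lookup; cartesianProductWith)
open import Data.List.NonEmpty as List⁺ using (List⁺; toList)
open import Data.List.Membership.Propositional using (_∈_)
open import Data.List.Membership.Propositional.Properties
  using (∈-map⁻; ∈-++⁻; ∈-++⁺ˡ; ∈-++⁺ʳ; ∈-cartesianProductWith⁺; ∈-cartesianProductWith⁻)
open import Data.List.Relation.Unary.Any using (here; there)
open import Data.Nat as ℕ using (ℕ)
import Data.Nat.Coprimality as Coprimality
import Data.Nat.Properties as ℕP
open import Data.Product using (∃₂; ∃-syntax; _×_; _,_)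
open import Data.Rational as ℚ using (ℚ; 0ℚ; 1ℚ; _/_)
import Data.Rational.Properties as ℚP
open import Algebra.Properties.Group ℚP.+-0-group using (∙-cancelˡ; \\-leftDividesʳ)
open import Data.Rational.Solver using (module +-*-Solver)
open import Data.Sum using (_⊎_; inj₁; inj₂)
open import Data.Vec as Vec using ([]; _∷_; zipWith; replicate)
import Data.Vec.Functional as Vector
import Data.Vec.Properties as VecP
open import Function using (_∘_)
open import Relation.Binary.Definitions using (tri<; tri≈; tri>)
open import Relation.Binary.PropositionalEquality
open import Relation.Nullary using (yes; no)

open import Defs
open +-*-Solver

+-cancelˡ-< : ∀ d {p q} → d ℚ.+ p ℚ.< d ℚ.+ q → p ℚ.< q
+-cancelˡ-< d {p} {q} lt =
  subst₂ ℚ._<_ (\\-leftDividesʳ d p) (\\-leftDividesʳ d q) (ℚP.+-monoʳ-< (ℚ.- d) lt)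

+-nonNeg : ∀ {p q} → 0ℚ ℚ.≤ p → 0ℚ ℚ.≤ q → 0ℚ ℚ.≤ p ℚ.+ q
+-nonNeg {p} {q} p≥0 q≥0 = subst (ℚ._≤ p ℚ.+ q) (ℚP.+-identityˡ 0ℚ) (ℚP.+-mono-≤ p≥0 q≥0)

module _ {n : ℕ} where

  0ᵥ : ℚPt n
  0ᵥ = replicate n 0ℚ

  +ᵥ-identityˡ : (v : ℚPt n) → 0ᵥ +ᵥ v ≡ v
  +ᵥ-identityˡ = VecP.zipWith-identityˡ ℚP.+-identityˡ

  +ᵥ-identityʳ : (v : ℚPt n) → v +ᵥ 0ᵥ ≡ v
  +ᵥ-identityʳ = VecP.zipWith-identityʳ ℚP.+-identityʳ

  ·ₛ-zeroˡ : (v : ℚPt n) → 0ℚ ·ₛ v ≡ 0ᵥ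
  ·ₛ-zeroˡ v = trans (VecP.map-cong ℚP.*-zeroˡ v) (VecP.map-const v 0ℚ)

  ·ₛ-identityˡ : (v : ℚPt n) → 1ℚ ·ₛ v ≡ v
  ·ₛ-identityˡ v = trans (VecP.map-cong ℚP.*-identityˡ v) (VecP.map-id v)

+ᵥ-cancelˡ : ∀ {n} (s y z : ℚPt n) → s +ᵥ y ≡ s +ᵥ z → y ≡ z
+ᵥ-cancelˡ [] [] [] _ = refl
+ᵥ-cancelˡ (s ∷ ss) (y ∷ ys) (z ∷ zs) eq =
  cong₂ _∷_ (∙-cancelˡ s y z (cong Vec.head eq)) (+ᵥ-cancelˡ ss ys zs (cong Vec.tail eq))

·ₛ-merge : ∀ {n} w w′ (a x : ℚPt n) → (w ·ₛ a) +ᵥ ((w′ ·ₛ a) +ᵥ x) ≡ ((w ℚ.+ w′) ·ₛ a) +ᵥ x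
·ₛ-merge w w′ [] [] = refl
·ₛ-merge w w′ (a ∷ as) (x ∷ xs) = cong₂ _∷_
  (solve 4 (λ w w′ a x → w :* a :+ (w′ :* a :+ x) := (w :+ w′) :* a :+ x) refl w w′ a x)
  (·ₛ-merge w w′ as xs)

+ᵥ-leftComm : ∀ {n} (u v x : ℚPt n) → u +ᵥ (v +ᵥ x) ≡ v +ᵥ (u +ᵥ x)
+ᵥ-leftComm [] [] [] = refl
+ᵥ-leftComm (u ∷ us) (v ∷ vs) (x ∷ xs) = cong₂ _∷_
  (solve 3 (λ u v x → u :+ (v :+ x) := v :+ (u :+ x)) refl u v x)
  (+ᵥ-leftComm us vs xs)

·ₛ-translate-step : ∀ {n} w t (s a x : ℚPt n) →
  (w ·ₛ (s +ᵥ a)) +ᵥ ((t ·ₛ s) +ᵥ x) ≡ ((w ℚ.+ t) ·ₛ s) +ᵥ ((w ·ₛ a) +ᵥ x)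
·ₛ-translate-step w t [] [] [] = refl
·ₛ-translate-step w t (s ∷ ss) (a ∷ as) (x ∷ xs) = cong₂ _∷_
  (solve 5 (λ w t s a x → w :* (s :+ a) :+ (t :* s :+ x) := (w :+ t) :* s :+ (w :* a :+ x))
     refl w t s a x)
  (·ₛ-translate-step w t ss as xs)

dot-0ᵥ : ∀ {n} (c : ℚPt n) → dot c 0ᵥ ≡ 0ℚ
dot-0ᵥ [] = refl
dot-0ᵥ (c ∷ cs) = trans (cong₂ ℚ._+_ (ℚP.*-zeroʳ c) (dot-0ᵥ cs)) (ℚP.+-identityˡ 0ℚ)

dot-+ᵥ : ∀ {n} (c u v : ℚPt n) → dot c (u +ᵥ v) ≡ dot c u ℚ.+ dot c v
dot-+ᵥ [] [] [] = sym (ℚP.+-identityˡ 0ℚ)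
dot-+ᵥ (c ∷ cs) (u ∷ us) (v ∷ vs) = trans (cong (c ℚ.* (u ℚ.+ v) ℚ.+_) (dot-+ᵥ cs us vs))
  (solve 5 (λ c u v p q → c :* (u :+ v) :+ (p :+ q) := (c :* u :+ p) :+ (c :* v :+ q))
     refl c u v (dot cs us) (dot cs vs))

dot-·ₛ : ∀ {n} (c : ℚPt n) w (u : ℚPt n) → dot c (w ·ₛ u) ≡ w ℚ.* dot c u
dot-·ₛ [] w [] = sym (ℚP.*-zeroʳ w)
dot-·ₛ (c ∷ cs) w (u ∷ us) = trans (cong (c ℚ.* (w ℚ.* u) ℚ.+_) (dot-·ₛ cs w us))
  (solve 4 (λ c w u p → c :* (w :* u) :+ w :* p := w :* (c :* u :+ p)) refl c w u (dot cs us))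

dot-·ₛ-+ᵥ : ∀ {n} (c : ℚPt n) w (u x : ℚPt n) → dot c ((w ·ₛ u) +ᵥ x) ≡ w ℚ.* dot c u ℚ.+ dot c x
dot-·ₛ-+ᵥ c w u x = trans (dot-+ᵥ c (w ·ₛ u) x) (cong (ℚ._+ dot c x) (dot-·ₛ c w u))

infixl 6 _+ₚ_

_+ₚ_ : ∀ {n} → Pt n → Pt n → Pt n
_+ₚ_ = zipWith ℕ._+_

+ₚ-identityˡ : ∀ {n} (a : Pt n) → replicate n 0 +ₚ a ≡ a
+ₚ-identityˡ = VecP.zipWith-identityˡ ℕP.+-identityˡ

+ₚ-leftComm : ∀ {n} (p s q : Pt n) → p +ₚ (s +ₚ q) ≡ s +ₚ (p +ₚ q)
+ₚ-leftComm [] [] [] = refl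
+ₚ-leftComm (p ∷ ps) (s ∷ ss) (q ∷ qs) = cong₂ _∷_
  (trans (sym (ℕP.+-assoc p s q)) (trans (cong (ℕ._+ q) (ℕP.+-comm p s)) (ℕP.+-assoc s p q)))
  (+ₚ-leftComm ps ss qs)

-- k / 1 is already in normal form, so addition of such fractions is addition of numerators.
/1-homo-+ : ∀ a b → (+ (a ℕ.+ b)) / 1 ≡ (+ a) / 1 ℚ.+ (+ b) / 1
/1-homo-+ a b
  rewrite ℚP.normalize-coprime (Coprimality.sym (Coprimality.1-coprimeTo a))
        | ℚP.normalize-coprime (Coprimality.sym (Coprimality.1-coprimeTo b))
  = cong (_/ 1) (sym (cong₂ ℤ._+_ (ℤP.*-identityʳ (+ a)) (ℤP.*-identityʳ (+ b))))

embed-+ₚ : ∀ {n} (a b : Pt n) → embed (a +ₚ b) ≡ embed a +ᵥ embed b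
embed-+ₚ [] [] = refl
embed-+ₚ (a ∷ as) (b ∷ bs) = cong₂ _∷_ (/1-homo-+ a b) (embed-+ₚ as bs)

data NonnegComb {n : ℕ} : ℚ → ℚPt n → List (Pt n) → Set where
  []   : NonnegComb 0ℚ 0ᵥ []
  cons : ∀ {w t x a L} → 0ℚ ℚ.≤ w → NonnegComb {n} t x L →
         NonnegComb (w ℚ.+ t) ((w ·ₛ embed a) +ᵥ x) (a ∷ L)

NonnegWeights : ∀ {n} → ℚ → ℚPt n → List (Pt n) → Set
NonnegWeights t x L =
  ∃[ w ] ((∀ i → 0ℚ ℚ.≤ w i) ×
          sumℚ (length L) w ≡ t ×
          sumᵥ (length L) (λ i → w i ·ₛ embed (lookup L i)) ≡ x)

module _ {n : ℕ} where

  weights⇒comb : ∀ {t x} (L : List (Pt n)) → NonnegWeights t x L → NonnegComb t x L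
  weights⇒comb []      (w , _ , refl , refl)   = []
  weights⇒comb (a ∷ L) (w , w≥0 , refl , refl) =
    cons (w≥0 zero) (weights⇒comb L (Vector.tail w , (λ i → w≥0 (suc i)) , refl , refl))

  comb⇒weights : ∀ {t x L} → NonnegComb {n} t x L → NonnegWeights t x L
  comb⇒weights [] = (λ ()) , (λ ()) , refl , refl
  comb⇒weights (cons {w = w} w≥0 c) with ws , ws≥0 , refl , refl ← comb⇒weights c =
    w Vector.∷ ws , nonNeg , refl , refl
    where
    nonNeg : ∀ i → 0ℚ ℚ.≤ (w Vector.∷ ws) i
    nonNeg zero    = w≥0
    nonNeg (suc i) = ws≥0 i

  comb-zero : (L : List (Pt n)) → NonnegComb 0ℚ 0ᵥ L
  comb-zero []      = []
  comb-zero (a ∷ L) = subst₂ (λ t x → NonnegComb t x (a ∷ L))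
    (ℚP.+-identityˡ 0ℚ) (trans (cong (_+ᵥ 0ᵥ) (·ₛ-zeroˡ (embed a))) (+ᵥ-identityˡ 0ᵥ))
    (cons ℚP.≤-refl (comb-zero L))

  comb-insert : ∀ {t x w a L} → a ∈ L → 0ℚ ℚ.≤ w → NonnegComb {n} t x L →
    NonnegComb (w ℚ.+ t) ((w ·ₛ embed a) +ᵥ x) L
  comb-insert {w = w} (here refl) w≥0 (cons {w = w′} {t} {x} {a} w′≥0 c) =
    subst₂ (λ t x → NonnegComb t x (a ∷ _))
      (ℚP.+-assoc w w′ t) (sym (·ₛ-merge w w′ (embed a) x))
      (cons (+-nonNeg w≥0 w′≥0) c)
  comb-insert {w = w} {a} (there a∈L) w≥0 (cons {w = w′} {t} {x} {b} w′≥0 c) =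
    subst₂ (λ t x → NonnegComb t x (b ∷ _))
      (solve 3 (λ w w′ t → w′ :+ (w :+ t) := w :+ (w′ :+ t)) refl w w′ t)
      (+ᵥ-leftComm (w′ ·ₛ embed b) (w ·ₛ embed a) x)
      (cons w′≥0 (comb-insert a∈L w≥0 c))

  comb-⊆ : ∀ {t x L L′} → (∀ {a} → a ∈ L → a ∈ L′) → NonnegComb {n} t x L → NonnegComb t x L′
  comb-⊆ {L′ = L′} _ []   = comb-zero L′
  comb-⊆ L⊆L′ (cons w≥0 c) =
    comb-insert (L⊆L′ (here refl)) w≥0 (comb-⊆ (λ a∈ → L⊆L′ (there a∈)) c)

  comb-point : ∀ {a L} → a ∈ L → NonnegComb {n} 1ℚ (embed a) L
  comb-point {a} a∈L = comb-⊆ (λ { (here refl) → a∈L })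
    (subst₂ (λ t x → NonnegComb t x (a ∷ []))
      (ℚP.+-identityʳ 1ℚ) (trans (+ᵥ-identityʳ _) (·ₛ-identityˡ (embed a)))
      (cons (ℚP.nonNegative⁻¹ 1ℚ) []))

  comb-translate : ∀ {t x L} (s : Pt n) → NonnegComb t x L →
    NonnegComb t ((t ·ₛ embed s) +ᵥ x) (List.map (s +ₚ_) L)
  comb-translate s [] = subst (λ x → NonnegComb 0ℚ x [])
    (sym (trans (cong (_+ᵥ 0ᵥ) (·ₛ-zeroˡ (embed s))) (+ᵥ-identityˡ 0ᵥ))) []
  comb-translate s (cons {w = w} {t} {x} {a} w≥0 c) =
    subst (λ y → NonnegComb (w ℚ.+ t) y _)
      (trans (cong (λ z → (w ·ₛ z) +ᵥ _) (embed-+ₚ s a))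
             (·ₛ-translate-step w t (embed s) (embed a) x))
      (cons w≥0 (comb-translate s c))

  comb-dot-≤ : ∀ {t x L} (c : ℚPt n) b → (∀ {a} → a ∈ L → dot c (embed a) ℚ.≤ b) →
    NonnegComb {n} t x L → dot c x ℚ.≤ t ℚ.* b
  comb-dot-≤ c b _ [] = ℚP.≤-reflexive (trans (dot-0ᵥ c) (sym (ℚP.*-zeroˡ b)))
  comb-dot-≤ c b bound (cons {w = w} {t} {x} {a} w≥0 comb) = begin
    dot c ((w ·ₛ embed a) +ᵥ x)         ≡⟨ dot-·ₛ-+ᵥ c w (embed a) x ⟩
    w ℚ.* dot c (embed a) ℚ.+ dot c x   ≤⟨ ℚP.+-mono-≤
                                             (ℚP.*-monoˡ-≤-nonNeg w {{ℚ.nonNegative w≥0}} (bound (here refl)))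
                                             (comb-dot-≤ c b (λ a∈ → bound (there a∈)) comb) ⟩
    w ℚ.* b ℚ.+ t ℚ.* b                 ≡⟨ ℚP.*-distribʳ-+ b w t ⟨
    (w ℚ.+ t) ℚ.* b                     ∎
    where open ℚP.≤-Reasoning

  comb-dot-< : ∀ {t x L} (c : ℚPt n) b → (∀ {a} → a ∈ L → dot c (embed a) ℚ.< b) →
    0ℚ ℚ.< t → NonnegComb {n} t x L → dot c x ℚ.< t ℚ.* b
  comb-dot-< c b _ 0<0 [] = ⊥-elim (ℚP.<-irrefl refl 0<0)
  comb-dot-< c b bound 0<w+t (cons {w = w} {t} {x} {a} w≥0 comb) with ℚP.<-cmp 0ℚ w
  ... | tri< 0<w _ _ = begin-strict
    dot c ((w ·ₛ embed a) +ᵥ x)         ≡⟨ dot-·ₛ-+ᵥ c w (embed a) x ⟩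
    w ℚ.* dot c (embed a) ℚ.+ dot c x   <⟨ ℚP.+-mono-<-≤
                                             (ℚP.*-monoʳ-<-pos w {{ℚ.positive 0<w}} (bound (here refl)))
                                             (comb-dot-≤ c b (λ a∈ → ℚP.<⇒≤ (bound (there a∈))) comb) ⟩
    w ℚ.* b ℚ.+ t ℚ.* b                 ≡⟨ ℚP.*-distribʳ-+ b w t ⟨
    (w ℚ.+ t) ℚ.* b                     ∎
    where open ℚP.≤-Reasoning
  ... | tri≈ _ refl _ = begin-strict
    dot c ((0ℚ ·ₛ embed a) +ᵥ x)        ≡⟨ cong (dot c) (trans (cong (_+ᵥ x) (·ₛ-zeroˡ (embed a)))
                                                                 (+ᵥ-identityˡ x)) ⟩
    dot c x                             <⟨ comb-dot-< c b (λ a∈ → bound (there a∈))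
                                             (subst (0ℚ ℚ.<_) (ℚP.+-identityˡ t) 0<w+t) comb ⟩
    t ℚ.* b                             ≡⟨ cong (ℚ._* b) (ℚP.+-identityˡ t) ⟨
    (0ℚ ℚ.+ t) ℚ.* b                    ∎
    where open ℚP.≤-Reasoning
  ... | tri> _ _ w<0 = ⊥-elim (ℚP.<-irrefl refl (ℚP.<-≤-trans w<0 w≥0))

  find-embedding : (x : ℚPt n) (L : List (Pt n)) →
    (∃[ a ] (a ∈ L × embed a ≡ x)) ⊎ (∀ {a} → a ∈ L → embed a ≢ x)
  find-embedding x [] = inj₂ λ ()
  find-embedding x (b ∷ L) with VecP.≡-dec ℚP._≟_ (embed b) x | find-embedding x L
  ... | yes b≡x | _                  = inj₁ (b , here refl , b≡x)
  ... | no _    | inj₁ (a , a∈ , a≡x) = inj₁ (a , there a∈ , a≡x)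
  ... | no b≢x  | inj₂ none          = inj₂ λ { (here refl) → b≢x ; (there a∈) → none a∈ }

  -- If x were not a generator, c would be strictly below c·x on every generator,
  -- hence c·x < 1 * c·x.
  comb-vertex-point : ∀ {x L} (c : ℚPt n) → NonnegComb {n} 1ℚ x L →
    (∀ y → NonnegComb 1ℚ y L → y ≢ x → dot c y ℚ.< dot c x) →
    ∃[ a ] (a ∈ L × embed a ≡ x)
  comb-vertex-point {x} {L} c x∈L maximal with find-embedding x L
  ... | inj₁ found = found
  ... | inj₂ none  = ⊥-elim (ℚP.<-irrefl (sym (ℚP.*-identityˡ (dot c x)))
    (comb-dot-< c (dot c x) (λ a∈ → maximal _ (comb-point a∈) (none a∈)) (ℚP.positive⁻¹ 1ℚ) x∈L))

  gens : Poly n → List (Pt n)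
  gens 0𝒜       = []
  gens (conv S) = toList S

  ∈ₚ⇒comb : ∀ P {x} → x ∈ₚ P → NonnegComb {n} 1ℚ x (gens P)
  ∈ₚ⇒comb (conv S) = weights⇒comb (toList S)

  comb⇒∈ₚ : ∀ P {x} → NonnegComb {n} 1ℚ x (gens P) → x ∈ₚ P
  comb⇒∈ₚ 0𝒜       ()
  comb⇒∈ₚ (conv S) = comb⇒weights

  gens-⊕⁻ : ∀ P Q {a} → a ∈ gens (P ⊕ Q) → a ∈ gens P ⊎ a ∈ gens Q
  gens-⊕⁻ 0𝒜       Q        = inj₂
  gens-⊕⁻ (conv S) 0𝒜       = inj₁
  gens-⊕⁻ (conv S) (conv T) = ∈-++⁻ (toList S)

  gens-⊕⁺ˡ : ∀ P Q {a} → a ∈ gens P → a ∈ gens (P ⊕ Q)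
  gens-⊕⁺ˡ (conv S) 0𝒜       a∈ = a∈
  gens-⊕⁺ˡ (conv S) (conv T) a∈ = ∈-++⁺ˡ a∈

  gens-⊕⁺ʳ : ∀ P Q {a} → a ∈ gens Q → a ∈ gens (P ⊕ Q)
  gens-⊕⁺ʳ 0𝒜       Q        a∈ = a∈
  gens-⊕⁺ʳ (conv S) (conv T) a∈ = ∈-++⁺ʳ (toList S) a∈

  gens-conv-⊙ : ∀ S T → gens (conv S ⊙ conv T) ≡ cartesianProductWith _+ₚ_ (toList S) (toList T)
  gens-conv-⊙ (s List⁺.∷ ss) T = cong (List.map (s +ₚ_) (toList T) ++_) (concat-map ss)
    where
    concat-map : ∀ ss → List.concat (List.map toList (List.map (λ s → List⁺.map (s +ₚ_) T) ss))
                        ≡ cartesianProductWith _+ₚ_ ss (toList T)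
    concat-map []       = refl
    concat-map (s ∷ ss) = cong (List.map (s +ₚ_) (toList T) ++_) (concat-map ss)

  gens-⊙⁻ : ∀ P Q {a} → a ∈ gens (P ⊙ Q) → ∃₂ λ p q → p ∈ gens P × q ∈ gens Q × a ≡ p +ₚ q
  gens-⊙⁻ (conv S) (conv T) {a} a∈ =
    ∈-cartesianProductWith⁻ _+ₚ_ (toList S) (toList T) (subst (a ∈_) (gens-conv-⊙ S T) a∈)

  gens-⊙⁺ : ∀ P Q {p q} → p ∈ gens P → q ∈ gens Q → p +ₚ q ∈ gens (P ⊙ Q)
  gens-⊙⁺ (conv S) (conv T) {p} {q} p∈ q∈ =
    subst (p +ₚ q ∈_) (sym (gens-conv-⊙ S T)) (∈-cartesianProductWith⁺ _+ₚ_ p∈ q∈)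

  gens-⨁⁻ : ∀ r (f : Fin r → Poly n) {a} → a ∈ gens (⨁ r f) → ∃[ j ] (a ∈ gens (f j))
  gens-⨁⁻ (ℕ.suc r) f a∈ with gens-⊕⁻ (f zero) (⨁ r (λ i → f (suc i))) a∈
  ... | inj₁ a∈f₀ = zero , a∈f₀
  ... | inj₂ a∈⨁ with j , a∈fj ← gens-⨁⁻ r (λ i → f (suc i)) a∈⨁ = suc j , a∈fj

  gens-⨁⁺ : ∀ r (f : Fin r → Poly n) j {a} → a ∈ gens (f j) → a ∈ gens (⨁ r f)
  gens-⨁⁺ (ℕ.suc r) f zero    a∈ = gens-⊕⁺ˡ (f zero) (⨁ r (λ i → f (suc i))) a∈
  gens-⨁⁺ (ℕ.suc r) f (suc j) a∈ =
    gens-⊕⁺ʳ (f zero) (⨁ r (λ i → f (suc i))) (gens-⨁⁺ r (λ i → f (suc i)) j a∈)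

  gen∈ₚ : ∀ P {a} → a ∈ gens P → embed a ∈ₚ P
  gen∈ₚ P a∈ = comb⇒∈ₚ P (comb-point a∈)

  vertex⇒gen : ∀ P {x} → IsVertex x P → ∃[ a ] (a ∈ gens P × embed a ≡ x)
  vertex⇒gen P (x∈P , c , maximal) =
    comb-vertex-point c (∈ₚ⇒comb P x∈P) (λ y y∈P → maximal y (comb⇒∈ₚ P y∈P))

  ∈ₚ-translate : ∀ A B s → (∀ {b} → b ∈ gens A → s +ₚ b ∈ gens B) →
    ∀ {y} → y ∈ₚ A → (embed s +ᵥ y) ∈ₚ B
  ∈ₚ-translate A B s shift {y} y∈A = comb⇒∈ₚ B (comb-⊆ shift′
    (subst (λ z → NonnegComb 1ℚ z _) (cong (_+ᵥ y) (·ₛ-identityˡ (embed s)))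
      (comb-translate s (∈ₚ⇒comb A y∈A))))
    where
    shift′ : ∀ {a} → a ∈ List.map (s +ₚ_) (gens A) → a ∈ gens B
    shift′ a∈ with b , b∈ , refl ← ∈-map⁻ (s +ₚ_) a∈ = shift b∈

  vertex-untranslate : ∀ A B s → (∀ {b} → b ∈ gens A → s +ₚ b ∈ gens B) →
    ∀ {x y} → IsVertex x B → y ∈ₚ A → embed s +ᵥ y ≡ x → IsVertex y A
  vertex-untranslate A B s shift (_ , c , maximal) y∈A refl = y∈A , c , λ z z∈A z≢y →
    +-cancelˡ-< (dot c (embed s)) (subst₂ ℚ._<_ (dot-+ᵥ c _ z) (dot-+ᵥ c _ _)
      (maximal _ (∈ₚ-translate A B s shift z∈A) (z≢y ∘ +ᵥ-cancelˡ _ z _)))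

  ⊙-translate : ∀ P Q Q′ s → (∀ {q} → q ∈ gens Q → s +ₚ q ∈ gens Q′) →
    ∀ {b} → b ∈ gens (P ⊙ Q) → s +ₚ b ∈ gens (P ⊙ Q′)
  ⊙-translate P Q Q′ s shift b∈ with p , q , p∈ , q∈ , refl ← gens-⊙⁻ P Q b∈ =
    subst (_∈ gens (P ⊙ Q′)) (+ₚ-leftComm p s q) (gens-⊙⁺ P Q′ p∈ (shift q∈))

  ⨁-translate : ∀ r (f g : Fin r → Poly n) s → (∀ i {b} → b ∈ gens (f i) → s +ₚ b ∈ gens (g i)) →
    ∀ {b} → b ∈ gens (⨁ r f) → s +ₚ b ∈ gens (⨁ r g)
  ⨁-translate r f g s shift b∈ with j , b∈fj ← gens-⨁⁻ r f b∈ = gens-⨁⁺ r g j (shift j b∈fj)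

module _ {n r : ℕ} (P : Fin r → Poly n) where

  CoveredTwice : (Fin r → Poly n) → ℚPt n → Set
  CoveredTwice Q x = ∃[ i ] ∃[ j ] (i ≢ j × x ∈ₚ (P i ⊙ Q i) × x ∈ₚ (P j ⊙ Q j))

  syzygy-translate : ∀ (Q Q′ : Fin r → Poly n) s →
    (∀ i {q} → q ∈ gens (Q i) → s +ₚ q ∈ gens (Q′ i)) → IsSyzygy r P Q →
    ∀ {x} → IsVertex x (⨁ r (λ j → P j ⊙ Q′ j)) →
    ∀ j {b} → b ∈ gens (P j ⊙ Q j) → embed (s +ₚ b) ≡ x → CoveredTwice Q′ x
  syzygy-translate Q Q′ s shift syz {x} x-vertex j {b} b∈ s+b≡x =
    transfer (syz (embed b) y-vertex)
    where
    summand-shift : ∀ i {b} → b ∈ gens (P i ⊙ Q i) → s +ₚ b ∈ gens (P i ⊙ Q′ i)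
    summand-shift i = ⊙-translate (P i) (Q i) (Q′ i) s (shift i)

    x≡s+y : embed s +ᵥ embed b ≡ x
    x≡s+y = trans (sym (embed-+ₚ s b)) s+b≡x

    y-vertex : IsVertex (embed b) (⨁ r (λ j → P j ⊙ Q j))
    y-vertex = vertex-untranslate _ _ s (⨁-translate r _ _ s summand-shift) x-vertex
      (gen∈ₚ _ (gens-⨁⁺ r _ j b∈)) x≡s+y

    translate : ∀ i → embed b ∈ₚ (P i ⊙ Q i) → x ∈ₚ (P i ⊙ Q′ i)
    translate i y∈ = subst (_∈ₚ (P i ⊙ Q′ i)) x≡s+y (∈ₚ-translate _ _ s (summand-shift i) y∈)

    transfer : CoveredTwice Q (embed b) → CoveredTwice Q′ x
    transfer (i , k , i≢k , y∈i , y∈k) = i , k , i≢k , translate i y∈i , translate k y∈k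

  syzygy-widen : ∀ (Q Q′ : Fin r → Poly n) →
    (∀ i {q} → q ∈ gens (Q i) → q ∈ gens (Q′ i)) → IsSyzygy r P Q →
    ∀ {x} → IsVertex x (⨁ r (λ j → P j ⊙ Q′ j)) →
    ∀ j {b} → b ∈ gens (P j ⊙ Q j) → embed b ≡ x → CoveredTwice Q′ x
  syzygy-widen Q Q′ Q⊆Q′ syz x-vertex j {b} b∈ b≡x =
    syzygy-translate Q Q′ (replicate n 0) zero-shift syz x-vertex j b∈
      (trans (cong embed (+ₚ-identityˡ b)) b≡x)
    where
    zero-shift : ∀ i {q} → q ∈ gens (Q i) → replicate n 0 +ₚ q ∈ gens (Q′ i)
    zero-shift i {q} q∈ = subst (_∈ gens (Q′ i)) (sym (+ₚ-identityˡ q)) (Q⊆Q′ i q∈)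

  syzygy-⊕ : (Q R : Fin r → Poly n) → IsSyzygy r P Q → IsSyzygy r P R →
    IsSyzygy r P (λ j → Q j ⊕ R j)
  syzygy-⊕ Q R syzQ syzR x x-vertex
    with a , a∈ , a≡x ← vertex⇒gen _ x-vertex
    with j , a∈j ← gens-⨁⁻ r _ a∈
    with p , q , p∈ , q∈ , refl ← gens-⊙⁻ (P j) (Q j ⊕ R j) a∈j
    with gens-⊕⁻ (Q j) (R j) q∈
  ... | inj₁ q∈Q = syzygy-widen Q _ (λ i → gens-⊕⁺ˡ (Q i) (R i)) syzQ x-vertex
                     j (gens-⊙⁺ (P j) (Q j) p∈ q∈Q) a≡x
  ... | inj₂ q∈R = syzygy-widen R _ (λ i → gens-⊕⁺ʳ (Q i) (R i)) syzR x-vertex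
                     j (gens-⊙⁺ (P j) (R j) p∈ q∈R) a≡x

  syzygy-⊙ : (Q : Fin r → Poly n) (S : Poly n) → IsSyzygy r P Q → IsSyzygy r P (λ j → S ⊙ Q j)
  syzygy-⊙ Q S syz x x-vertex
    with a , a∈ , a≡x ← vertex⇒gen _ x-vertex
    with j , a∈j ← gens-⨁⁻ r _ a∈
    with p , u , p∈ , u∈ , refl ← gens-⊙⁻ (P j) (S ⊙ Q j) a∈j
    with s , q , s∈ , q∈ , refl ← gens-⊙⁻ S (Q j) u∈ =
    syzygy-translate Q _ s (λ i → gens-⊙⁺ S (Q i) s∈) syz x-vertex
      j (gens-⊙⁺ (P j) (Q j) p∈ q∈) (trans (cong embed (sym (+ₚ-leftComm p s q))) a≡x)

mainTheorem15 : (n r : ℕ) (P Q R : Fin r → Poly n) (S : Poly n) →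
    IsSyzygy r P Q → IsSyzygy r P R →
    IsSyzygy r P (λ j → Q j ⊕ R j) × IsSyzygy r P (λ j → S ⊙ Q j)
mainTheorem15 n r P Q R S syzQ syzR = syzygy-⊕ P Q R syzQ syzR , syzygy-⊙ P Q S syzQ
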